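{- Let $n\ge2$, $d=\frac n2-1\ge 0$, and let $C$ be an $n\times n$ circulant matrix with generator $(c_0,\ldots,c_{n-1})$ such that $c_0=d$, $c_j\in\{1,-1\}$ for $j=1,\ldots,n-1$, and $CC^T=(d^2+n-1)I$. Suppose that for every $j=1,\ldots,n-1$ we have $c_j=1$ or $c_{n-j}=1$. Then either $n=2$ and $$C=C_2:=\begin{pmatrix}0&1\\1&0\end{pmatrix},$$ or $n=4$ and $C$ equals one of $$C_{4a}:=\begin{pmatrix}1&1&1&-1\\-1&1&1&1\\1&-1&1&1\\1&1&-1&1\end{pmatrix},\qquad C_{4b}:=\begin{pmatrix}1&-1&1&1\\1&1&-1&1\\1&1&1&-1\\-1&1&1&1\end{pmatrix}.$$
   Context: A circulant matrix of order $n$ with generator $(c_0,c_1,\ldots,c_{n-1})$ is the $n\times n$ matrix whose entry in row $i$ and column $j$ (indices $0,\ldots,n-1$) is $c_{(j-i)\bmod n}$. -}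

module Defs where

open import Data.Nat as ℕ using (ℕ; zero; suc)
open import Data.Nat.DivMod using (_%_; m%n<n)
open import Data.Fin using (Fin; toℕ; fromℕ<; _≟_)
open import Data.Rational using (ℚ; 0ℚ; 1ℚ; -_; _+_; _*_)
open import Relation.Nullary using (yes; no)
open import Data.Vec using (Vec; []; _∷_; lookup)

Mat : ℕ → Set
Mat n = Fin n → Fin n → ℚ

modSub : {n : ℕ} → Fin n → Fin n → Fin n
modSub {zero} () _
modSub {suc n} j i = fromℕ< (m%n<n (toℕ j ℕ.+ (suc n ℕ.∸ toℕ i)) (suc n))

circulant : {n : ℕ} → (Fin n → ℚ) → Mat n
circulant c i j = c (modSub j i)

sumFin : (n : ℕ) → (Fin n → ℚ) → ℚ
sumFin zero f = 0ℚ
sumFin (suc n) f = f Data.Fin.zero + sumFin n (λ k → f (Data.Fin.suc k))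

mulTranspose : {n : ℕ} → Mat n → Mat n → Mat n
mulTranspose {n} A B i j = sumFin n (λ k → A i k * B j k)

scalarId : {n : ℕ} → ℚ → Mat n
scalarId a i j with i ≟ j
... | yes _ = a
... | no _ = 0ℚ

ℕtoℚ : ℕ → ℚ
ℕtoℚ zero = 0ℚ
ℕtoℚ (suc n) = 1ℚ + ℕtoℚ n

fromRows : {n : ℕ} → Vec (Vec ℚ n) n → Mat n
fromRows rows i j = lookup (lookup rows i) j

-1ℚ : ℚ
-1ℚ = - 1ℚ

C₂ : Mat 2
C₂ = fromRows ((0ℚ ∷ 1ℚ ∷ []) ∷ (1ℚ ∷ 0ℚ ∷ []) ∷ [])

C₄a : Mat 4
C₄a = fromRows
  ( (1ℚ ∷ 1ℚ ∷ 1ℚ ∷ -1ℚ ∷ [])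
  ∷ (-1ℚ ∷ 1ℚ ∷ 1ℚ ∷ 1ℚ ∷ [])
  ∷ (1ℚ ∷ -1ℚ ∷ 1ℚ ∷ 1ℚ ∷ [])
  ∷ (1ℚ ∷ 1ℚ ∷ -1ℚ ∷ 1ℚ ∷ [])
  ∷ [])

C₄b : Mat 4
C₄b = fromRows
  ( (1ℚ ∷ -1ℚ ∷ 1ℚ ∷ 1ℚ ∷ [])
  ∷ (1ℚ ∷ 1ℚ ∷ -1ℚ ∷ 1ℚ ∷ [])
  ∷ (1ℚ ∷ 1ℚ ∷ 1ℚ ∷ -1ℚ ∷ [])
  ∷ (-1ℚ ∷ 1ℚ ∷ 1ℚ ∷ 1ℚ ∷ [])
  ∷ [])

negIdx : {n : ℕ} → Fin n → Fin n
negIdx {zero} ()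
negIdx {suc n} j = modSub Data.Fin.zero j

module Submission where

-- Extend c periodically to ℕ. Row k of C times row 0 is the autocorrelation
-- A(k) = ∑_{m<n} c_m c_{m+k}, so A(0) = d² + n - 1 and A(k) = 0 otherwise.
--  1. ∑_k A(k) = (∑ c)², i.e. (d + S)² = d² + n - 1 with S = c₁ + … + c_{n-1}; since n = 2d + 2
--     this factors as (S - 1)(S + n - 1) = 0, and S = 1 - n would make every cₖ = -1.
--     So S = 1, and n - 1 signs summing to 1 force n = 2h.
--  2. c_h = 1; A(h) = 0 forces c_{m+h} = -c_m (m ≠ 0, h), and with the hypothesis on cₖ, c_{n-k}
--     the entries c₁, …, c_{h-1} form a palindrome. Then A(k) = 0 for 0 < k < h becomes
--     ∑_{m<h} c_m c_{m+k} = (d + 1) c_k.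
--  3. For h ≥ 3, lags 1 and 2 give sums of ±1 terms whose values and telescoping products fix the
--     number of -1's modulo 4 in two incompatible ways. So h ∈ {1, 2}, which pins down c.

open import Defs
open import Data.Nat as ℕ using (ℕ; _≤_; _<_; zero; suc; z≤n; s≤s; z<s; _∸_)
import Data.Nat.Properties as ℕP
open import Data.Nat.DivMod using (m%n<n; m<n⇒m%n≡m; [m+n]%n≡m%n)
open import Data.Fin as Fin using (Fin; toℕ; cast; fromℕ<) renaming (zero to fzero; suc to fsuc)
import Data.Fin.Properties as FinP
open import Data.Rational using (ℚ; _+_; _*_; _-_; ½; 1ℚ; 0ℚ; -_; 1/_; ≢-nonZero)
  renaming (_≤_ to _≤ℚ_)
open import Data.Rational.Properties
  using ( _≟_; +-identityˡ; +-identityʳ; +-assoc; +-comm; *-identityˡ; *-identityʳ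
        ; *-assoc; *-comm; *-zeroʳ; *-distribˡ-+; *-inverseˡ
        ; ≤-refl; ≤-antisym; +-mono-≤; +-monoʳ-≤; nonNegative⁻¹; +-0-group; module ≤-Reasoning)
open import Data.Rational.Solver using (module +-*-Solver)
open import Algebra.Properties.Group +-0-group using (∙-cancelˡ)
open import Algebra.Properties.CommutativeSemigroup ℕP.+-commutativeSemigroup
  using (x∙yz≈y∙xz; xy∙z≈xz∙y; xy∙z≈y∙xz)
open import Data.Product using (Σ; _,_; _×_)
open import Data.Sum using (_⊎_; inj₁; inj₂; [_,_]′; map₁; map₂)
open import Data.Empty using (⊥; ⊥-elim)
open import Data.Vec using (_∷_; []; lookup)
open import Function using (id)
open import Relation.Nullary using (yes; no)
open import Relation.Nullary.Decidable using (True; toWitness)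
open import Relation.Binary.Definitions using (tri<; tri≈; tri>)
open import Relation.Binary.PropositionalEquality
  using (_≡_; _≢_; refl; sym; trans; cong; cong₂; subst; subst₂; module ≡-Reasoning)

open +-*-Solver using (solve; _:+_; _:-_; _:*_; :-_; _:=_; con)

IsSign : ℚ → Set
IsSign x = (x ≡ 1ℚ) ⊎ (x ≡ -1ℚ)

1≢-1 : 1ℚ ≢ -1ℚ
1≢-1 ()

2≢0 : 1ℚ + 1ℚ ≢ 0ℚ
2≢0 ()

sign² : ∀ {x} → IsSign x → x * x ≡ 1ℚ
sign² (inj₁ refl) = refl
sign² (inj₂ refl) = refl

sign-* : ∀ {x y} → IsSign x → IsSign y → IsSign (x * y)
sign-* (inj₁ refl) (inj₁ refl) = inj₁ refl
sign-* (inj₁ refl) (inj₂ refl) = inj₂ refl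
sign-* (inj₂ refl) (inj₁ refl) = inj₂ refl
sign-* (inj₂ refl) (inj₂ refl) = inj₁ refl

-- A sign is its own inverse, so multiplication by it can be cancelled.
sign-cancel : ∀ {x} y z → IsSign x → x * y ≡ x * z → y ≡ z
sign-cancel {x} y z sx xy≡xz = begin
  y               ≡⟨ sym (*-identityˡ y) ⟩
  1ℚ * y          ≡⟨ cong (_* y) (sym (sign² sx)) ⟩
  (x * x) * y     ≡⟨ *-assoc x x y ⟩
  x * (x * y)     ≡⟨ cong (x *_) xy≡xz ⟩
  x * (x * z)     ≡⟨ sym (*-assoc x x z) ⟩
  (x * x) * z     ≡⟨ cong (_* z) (sign² sx) ⟩
  1ℚ * z          ≡⟨ *-identityˡ z ⟩
  z               ∎
  where open ≡-Reasoning

sign-opposite : ∀ {x} y → IsSign x → 1ℚ + x * y ≡ 0ℚ → y ≡ - x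
sign-opposite y (inj₁ refl) e = begin
  y                          ≡⟨ solve 1 (λ y → y := (con 1ℚ :+ con 1ℚ :* y) :- con 1ℚ) refl y ⟩
  (1ℚ + 1ℚ * y) - 1ℚ         ≡⟨ cong (_- 1ℚ) e ⟩
  - 1ℚ                       ∎
  where open ≡-Reasoning
sign-opposite y (inj₂ refl) e = begin
  y                          ≡⟨ solve 1 (λ y → y := :- ((con 1ℚ :+ con -1ℚ :* y) :- con 1ℚ)) refl y ⟩
  - ((1ℚ + -1ℚ * y) - 1ℚ)    ≡⟨ cong (λ z → - (z - 1ℚ)) e ⟩
  1ℚ                         ∎
  where open ≡-Reasoning

-- 1 + x ≥ 0 for a sign x, so that sums of such terms can only vanish termwise.
sign-1+ : ∀ {x} → IsSign x → 0ℚ ≤ℚ 1ℚ + x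
sign-1+ (inj₁ refl) = nonNegative⁻¹ (1ℚ + 1ℚ)
sign-1+ (inj₂ refl) = ≤-refl

signs-agree : ∀ {x y} → IsSign x → IsSign y → (x ≡ 1ℚ) ⊎ (- y ≡ 1ℚ) → (y ≡ 1ℚ) ⊎ (- x ≡ 1ℚ) → x ≡ y
signs-agree (inj₁ refl) (inj₁ refl) _ _ = refl
signs-agree (inj₁ refl) (inj₂ refl) _ (inj₁ ())
signs-agree (inj₁ refl) (inj₂ refl) _ (inj₂ ())
signs-agree (inj₂ refl) (inj₁ refl) (inj₁ ()) _
signs-agree (inj₂ refl) (inj₁ refl) (inj₂ ()) _
signs-agree (inj₂ refl) (inj₂ refl) _ _ = refl

alt : ℕ → ℚ
alt zero = 1ℚ
alt (suc M) = - alt M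

parity-clash : ∀ s → (Σ ℕ λ M₁ → (suc s ≡ 2 ℕ.* M₁) × (alt M₁ ≡ 1ℚ)) →
                     (Σ ℕ λ M₂ → (s ≡ suc (2 ℕ.* M₂)) × (alt M₂ ≡ 1ℚ)) → ⊥
parity-clash s (M₁ , 1+s≡2M₁ , alt₁) (M₂ , s≡1+2M₂ , alt₂) =
  1≢-1 (trans (sym (subst (λ x → alt x ≡ 1ℚ) M₁≡1+M₂ alt₁)) (cong -_ alt₂))
  where
  M₁≡1+M₂ : M₁ ≡ suc M₂
  M₁≡1+M₂ = ℕP.*-cancelˡ-≡ M₁ (suc M₂) 2
              (trans (sym 1+s≡2M₁) (trans (cong suc s≡1+2M₂) (sym (ℕP.*-suc 2 M₂))))

nonneg-+-zero : ∀ {x y} → 0ℚ ≤ℚ x → 0ℚ ≤ℚ y → x + y ≡ 0ℚ → x ≡ 0ℚ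
nonneg-+-zero {x} {y} 0≤x 0≤y x+y≡0 = ≤-antisym x≤0 0≤x
  where
  open ≤-Reasoning
  x≤0 : x ≤ℚ 0ℚ
  x≤0 = begin
    x       ≡⟨ sym (+-identityʳ x) ⟩
    x + 0ℚ  ≤⟨ +-monoʳ-≤ x 0≤y ⟩
    x + y   ≡⟨ x+y≡0 ⟩
    0ℚ      ∎

*-zero-cancel : ∀ x y → x ≢ 0ℚ → x * y ≡ 0ℚ → y ≡ 0ℚ
*-zero-cancel x y x≢0 xy≡0 = begin
  y                ≡⟨ sym (*-identityˡ y) ⟩
  1ℚ * y           ≡⟨ cong (_* y) (sym (*-inverseˡ x)) ⟩
  (1/ x * x) * y   ≡⟨ *-assoc (1/ x) x y ⟩
  1/ x * (x * y)   ≡⟨ cong (1/ x *_) xy≡0 ⟩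
  1/ x * 0ℚ        ≡⟨ *-zeroʳ (1/ x) ⟩
  0ℚ               ∎
  where
  open ≡-Reasoning
  instance _ = ≢-nonZero x≢0

ℕtoℚ-+ : ∀ a b → ℕtoℚ (a ℕ.+ b) ≡ ℕtoℚ a + ℕtoℚ b
ℕtoℚ-+ zero b = sym (+-identityˡ (ℕtoℚ b))
ℕtoℚ-+ (suc a) b = trans (cong (1ℚ +_) (ℕtoℚ-+ a b)) (sym (+-assoc 1ℚ (ℕtoℚ a) (ℕtoℚ b)))

ℕtoℚ-nonneg : ∀ a → 0ℚ ≤ℚ ℕtoℚ a
ℕtoℚ-nonneg zero = ≤-refl
ℕtoℚ-nonneg (suc a) = +-mono-≤ (nonNegative⁻¹ 1ℚ) (ℕtoℚ-nonneg a)

ℕtoℚ-suc≢0 : ∀ a → ℕtoℚ (suc a) ≢ 0ℚ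
ℕtoℚ-suc≢0 a e with nonneg-+-zero (nonNegative⁻¹ 1ℚ) (ℕtoℚ-nonneg a) e
... | ()

ℕtoℚ-injective : ∀ a b → ℕtoℚ a ≡ ℕtoℚ b → a ≡ b
ℕtoℚ-injective zero zero _ = refl
ℕtoℚ-injective zero (suc b) e = ⊥-elim (ℕtoℚ-suc≢0 b (sym e))
ℕtoℚ-injective (suc a) zero e = ⊥-elim (ℕtoℚ-suc≢0 a e)
ℕtoℚ-injective (suc a) (suc b) e = cong suc (ℕtoℚ-injective a b (∙-cancelˡ 1ℚ (ℕtoℚ a) (ℕtoℚ b) e))

∑ : ℕ → (ℕ → ℚ) → ℚ
∑ zero f = 0ℚ
∑ (suc N) f = f 0 + ∑ N (λ m → f (suc m))

∏ : ℕ → (ℕ → ℚ) → ℚ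
∏ zero f = 1ℚ
∏ (suc N) f = f 0 * ∏ N (λ m → f (suc m))

∑-cong : ∀ N {f g : ℕ → ℚ} → (∀ m → m < N → f m ≡ g m) → ∑ N f ≡ ∑ N g
∑-cong zero _ = refl
∑-cong (suc N) f≡g = cong₂ _+_ (f≡g 0 z<s) (∑-cong N (λ m m<N → f≡g (suc m) (s≤s m<N)))

∏-cong : ∀ N {f g : ℕ → ℚ} → (∀ m → m < N → f m ≡ g m) → ∏ N f ≡ ∏ N g
∏-cong zero _ = refl
∏-cong (suc N) f≡g = cong₂ _*_ (f≡g 0 z<s) (∏-cong N (λ m m<N → f≡g (suc m) (s≤s m<N)))

∑-zero : ∀ N (f : ℕ → ℚ) → (∀ m → m < N → f m ≡ 0ℚ) → ∑ N f ≡ 0ℚ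
∑-zero N f f≡0 = trans (∑-cong N f≡0) (lemma N)
  where
  lemma : ∀ N → ∑ N (λ _ → 0ℚ) ≡ 0ℚ
  lemma zero = refl
  lemma (suc N) = cong (0ℚ +_) (lemma N)

∑-const1 : ∀ N → ∑ N (λ _ → 1ℚ) ≡ ℕtoℚ N
∑-const1 zero = refl
∑-const1 (suc N) = cong (1ℚ +_) (∑-const1 N)

∑-+ : ∀ N (f g : ℕ → ℚ) → ∑ N (λ m → f m + g m) ≡ ∑ N f + ∑ N g
∑-+ zero f g = refl
∑-+ (suc N) f g = begin
  (f 0 + g 0) + ∑ N (λ m → f (suc m) + g (suc m))
    ≡⟨ cong ((f 0 + g 0) +_) (∑-+ N (λ m → f (suc m)) (λ m → g (suc m))) ⟩
  (f 0 + g 0) + (F + G)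
    ≡⟨ solve 4 (λ a b c d → (a :+ b) :+ (c :+ d) := (a :+ c) :+ (b :+ d)) refl (f 0) (g 0) F G ⟩
  (f 0 + F) + (g 0 + G) ∎
  where
  open ≡-Reasoning
  F = ∑ N (λ m → f (suc m))
  G = ∑ N (λ m → g (suc m))

∑-*ˡ : ∀ N x (f : ℕ → ℚ) → ∑ N (λ m → x * f m) ≡ x * ∑ N f
∑-*ˡ zero x f = sym (*-zeroʳ x)
∑-*ˡ (suc N) x f =
  trans (cong (x * f 0 +_) (∑-*ˡ N x (λ m → f (suc m)))) (sym (*-distribˡ-+ x (f 0) _))

∑-last : ∀ N (f : ℕ → ℚ) → ∑ (suc N) f ≡ ∑ N f + f N
∑-last zero f = trans (+-identityʳ (f 0)) (sym (+-identityˡ (f 0)))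
∑-last (suc N) f =
  trans (cong (f 0 +_) (∑-last N (λ m → f (suc m)))) (sym (+-assoc (f 0) _ _))

∏-last : ∀ N (f : ℕ → ℚ) → ∏ (suc N) f ≡ ∏ N f * f N
∏-last zero f = trans (*-identityʳ (f 0)) (sym (*-identityˡ (f 0)))
∏-last (suc N) f =
  trans (cong (f 0 *_) (∏-last N (λ m → f (suc m)))) (sym (*-assoc (f 0) _ _))

∑-split : ∀ A B (f : ℕ → ℚ) → ∑ (A ℕ.+ B) f ≡ ∑ A f + ∑ B (λ m → f (A ℕ.+ m))
∑-split zero B f = sym (+-identityˡ _)
∑-split (suc A) B f =
  trans (cong (f 0 +_) (∑-split A B (λ m → f (suc m)))) (sym (+-assoc (f 0) _ _))

∑-swap : ∀ A B (F : ℕ → ℕ → ℚ) → ∑ A (λ k → ∑ B (F k)) ≡ ∑ B (λ m → ∑ A (λ k → F k m))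
∑-swap zero B F = sym (∑-zero B (λ _ → 0ℚ) (λ _ _ → refl))
∑-swap (suc A) B F =
  trans (cong (∑ B (F 0) +_) (∑-swap A B (λ k → F (suc k))))
        (sym (∑-+ B (F 0) (λ m → ∑ A (λ k → F (suc k) m))))

∑-single : ∀ N p (f : ℕ → ℚ) → p < N → (∀ m → m < N → m ≢ p → f m ≡ 0ℚ) → ∑ N f ≡ f p
∑-single (suc N) zero f _ f≡0 =
  trans (cong (f 0 +_) (∑-zero N _ (λ m m<N → f≡0 (suc m) (s≤s m<N) (λ ())))) (+-identityʳ (f 0))
∑-single (suc N) (suc p) f (s≤s p<N) f≡0 =
  trans (cong (_+ ∑ N (λ m → f (suc m))) (f≡0 0 z<s (λ ())))
        (trans (+-identityˡ _)
               (∑-single N p (λ m → f (suc m)) p<N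
                  (λ m m<N m≢p → f≡0 (suc m) (s≤s m<N) (λ e → m≢p (ℕP.suc-injective e)))))

∑-nonneg : ∀ N (f : ℕ → ℚ) → (∀ m → m < N → 0ℚ ≤ℚ f m) → 0ℚ ≤ℚ ∑ N f
∑-nonneg zero f _ = ≤-refl
∑-nonneg (suc N) f 0≤f =
  +-mono-≤ (0≤f 0 z<s) (∑-nonneg N (λ m → f (suc m)) (λ m m<N → 0≤f (suc m) (s≤s m<N)))

∑-nonneg-zero : ∀ N (f : ℕ → ℚ) → (∀ m → m < N → 0ℚ ≤ℚ f m) → ∑ N f ≡ 0ℚ →
                ∀ m → m < N → f m ≡ 0ℚ
∑-nonneg-zero (suc N) f 0≤f ∑≡0 zero _ =
  nonneg-+-zero (0≤f 0 z<s) (∑-nonneg N _ (λ m m<N → 0≤f (suc m) (s≤s m<N))) ∑≡0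
∑-nonneg-zero (suc N) f 0≤f ∑≡0 (suc m) (s≤s m<N) =
  ∑-nonneg-zero N (λ m → f (suc m)) 0≤tail tail≡0 m m<N
  where
  0≤tail : ∀ m → m < N → 0ℚ ≤ℚ f (suc m)
  0≤tail m m<N = 0≤f (suc m) (s≤s m<N)
  tail≡0 : ∑ N (λ m → f (suc m)) ≡ 0ℚ
  tail≡0 = nonneg-+-zero (∑-nonneg N _ 0≤tail) (0≤f 0 z<s) (trans (+-comm _ (f 0)) ∑≡0)

sign-count : ∀ N (f : ℕ → ℚ) → (∀ m → m < N → IsSign (f m)) →
             Σ ℕ λ M → (ℕtoℚ N ≡ ∑ N f + ℕtoℚ (2 ℕ.* M)) × (∏ N f ≡ alt M)
sign-count zero f _ = 0 , refl , refl
sign-count (suc N) f sf with sign-count N (λ m → f (suc m)) (λ m m<N → sf (suc m) (s≤s m<N)) | sf 0 z<s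
... | M , sum≡ , prod≡ | inj₁ f0≡1 = M , sum≡′ , prod≡′
  where
  open ≡-Reasoning
  S = ∑ N (λ m → f (suc m))
  sum≡′ : 1ℚ + ℕtoℚ N ≡ (f 0 + S) + ℕtoℚ (2 ℕ.* M)
  sum≡′ = begin
    1ℚ + ℕtoℚ N                     ≡⟨ cong (1ℚ +_) sum≡ ⟩
    1ℚ + (S + ℕtoℚ (2 ℕ.* M))       ≡⟨ sym (+-assoc 1ℚ S _) ⟩
    (1ℚ + S) + ℕtoℚ (2 ℕ.* M)       ≡⟨ cong (λ x → (x + S) + ℕtoℚ (2 ℕ.* M)) (sym f0≡1) ⟩
    (f 0 + S) + ℕtoℚ (2 ℕ.* M)      ∎
  prod≡′ : f 0 * ∏ N (λ m → f (suc m)) ≡ alt M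
  prod≡′ = trans (cong₂ _*_ f0≡1 prod≡) (*-identityˡ (alt M))
... | M , sum≡ , prod≡ | inj₂ f0≡-1 = suc M , sum≡′ , prod≡′
  where
  open ≡-Reasoning
  S = ∑ N (λ m → f (suc m))
  D = ℕtoℚ (2 ℕ.* M)
  sum≡′ : 1ℚ + ℕtoℚ N ≡ (f 0 + S) + ℕtoℚ (2 ℕ.* suc M)
  sum≡′ = begin
    1ℚ + ℕtoℚ N                          ≡⟨ cong (1ℚ +_) sum≡ ⟩
    1ℚ + (S + D)                         ≡⟨ solve 2 (λ S D → con 1ℚ :+ (S :+ D) := (con -1ℚ :+ S) :+ (con 1ℚ :+ (con 1ℚ :+ D))) refl S D ⟩
    (-1ℚ + S) + (1ℚ + (1ℚ + D))          ≡⟨ cong₂ (λ x y → (x + S) + y) (sym f0≡-1) (cong ℕtoℚ (sym (ℕP.*-suc 2 M))) ⟩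
    (f 0 + S) + ℕtoℚ (2 ℕ.* suc M)       ∎
  prod≡′ : f 0 * ∏ N (λ m → f (suc m)) ≡ - alt M
  prod≡′ = trans (cong₂ _*_ f0≡-1 prod≡) (solve 1 (λ a → con -1ℚ :* a := :- a) refl (alt M))

sign-count-even : ∀ N (f : ℕ → ℚ) r → (∀ m → m < N → IsSign (f m)) → ∑ N f ≡ ℕtoℚ r → ∏ N f ≡ 1ℚ →
                  Σ ℕ λ M → (N ≡ r ℕ.+ 2 ℕ.* M) × (alt M ≡ 1ℚ)
sign-count-even N f r sf ∑≡r ∏≡1 with sign-count N f sf
... | M , sum≡ , prod≡ =
  M , ℕtoℚ-injective N (r ℕ.+ 2 ℕ.* M) (trans sum≡ (trans (cong (_+ ℕtoℚ (2 ℕ.* M)) ∑≡r) (sym (ℕtoℚ-+ r (2 ℕ.* M)))))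
    , trans (sym prod≡) ∏≡1

∏-telescope : ∀ k N (b : ℕ → ℚ) → (∀ j → j < N → b j * b j ≡ 1ℚ) →
              ∏ k b * ∏ N (λ j → b j * b (k ℕ.+ j)) ≡ ∏ k (λ j → b (N ℕ.+ j))
∏-telescope k zero b _ = *-identityʳ (∏ k b)
∏-telescope k (suc N) b b²≡1 = begin
  ∏ k b * ∏ (suc N) F                    ≡⟨ cong (∏ k b *_) (∏-last N F) ⟩
  ∏ k b * (∏ N F * F N)                  ≡⟨ sym (*-assoc (∏ k b) (∏ N F) (F N)) ⟩
  (∏ k b * ∏ N F) * F N                  ≡⟨ cong (_* F N) (∏-telescope k N b (λ j j<N → b²≡1 j (ℕP.m<n⇒m<1+n j<N))) ⟩
  window N * (b N * b (k ℕ.+ N))         ≡⟨ solve 3 (λ w x y → w :* (x :* y) := x :* (w :* y)) refl (window N) (b N) (b (k ℕ.+ N)) ⟩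
  b N * (window N * b (k ℕ.+ N))         ≡⟨ cong (λ i → b N * (window N * b i)) (ℕP.+-comm k N) ⟩
  b N * (window N * b (N ℕ.+ k))         ≡⟨ cong (b N *_) (sym (∏-last k (λ j → b (N ℕ.+ j)))) ⟩
  b N * (b (N ℕ.+ 0) * shifted)          ≡⟨ cong (λ i → b N * (b i * shifted)) (ℕP.+-identityʳ N) ⟩
  b N * (b N * shifted)                  ≡⟨ sym (*-assoc (b N) (b N) shifted) ⟩
  (b N * b N) * shifted                  ≡⟨ cong (_* shifted) (b²≡1 N (ℕP.n<1+n N)) ⟩
  1ℚ * shifted                           ≡⟨ *-identityˡ shifted ⟩
  shifted                                ≡⟨ ∏-cong k (λ j _ → cong b (ℕP.+-suc N j)) ⟩
  window (suc N)                         ∎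
  where
  open ≡-Reasoning
  F : ℕ → ℚ
  F j = b j * b (k ℕ.+ j)
  window : ℕ → ℚ
  window N = ∏ k (λ j → b (N ℕ.+ j))
  shifted = ∏ k (λ j → b (N ℕ.+ suc j))

Periodic : ℕ → (ℕ → ℚ) → Set
Periodic N f = ∀ m → f (m ℕ.+ N) ≡ f m

∑-rotate : ∀ N (g : ℕ → ℚ) → g N ≡ g 0 → ∑ N (λ m → g (suc m)) ≡ ∑ N g
∑-rotate zero g _ = refl
∑-rotate (suc N) g wrap = begin
  ∑ (suc N) (λ m → g (suc m))          ≡⟨ ∑-last N (λ m → g (suc m)) ⟩
  ∑ N (λ m → g (suc m)) + g (suc N)    ≡⟨ cong (∑ N (λ m → g (suc m)) +_) wrap ⟩
  ∑ N (λ m → g (suc m)) + g 0          ≡⟨ +-comm (∑ N (λ m → g (suc m))) (g 0) ⟩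
  ∑ (suc N) g                          ∎
  where open ≡-Reasoning

∑-shift : ∀ N (f : ℕ → ℚ) → Periodic N f → ∀ k → ∑ N (λ m → f (k ℕ.+ m)) ≡ ∑ N f
∑-shift N f per zero = refl
∑-shift N f per (suc k) = begin
  ∑ N (λ m → f (suc k ℕ.+ m))      ≡⟨ ∑-cong N (λ m _ → cong f (sym (ℕP.+-suc k m))) ⟩
  ∑ N (λ m → f (k ℕ.+ suc m))      ≡⟨ ∑-rotate N (λ m → f (k ℕ.+ m)) wrap ⟩
  ∑ N (λ m → f (k ℕ.+ m))          ≡⟨ ∑-shift N f per k ⟩
  ∑ N f                            ∎
  where
  open ≡-Reasoning
  wrap : f (k ℕ.+ N) ≡ f (k ℕ.+ 0)
  wrap = trans (per k) (cong f (sym (ℕP.+-identityʳ k)))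

autocorr : ℕ → (ℕ → ℚ) → ℕ → ℚ
autocorr N f k = ∑ N (λ m → f m * f (k ℕ.+ m))

autocorr-total : ∀ N (f : ℕ → ℚ) → Periodic N f → ∑ N (autocorr N f) ≡ ∑ N f * ∑ N f
autocorr-total N f per = begin
  ∑ N (λ k → ∑ N (λ m → f m * f (k ℕ.+ m)))    ≡⟨ ∑-swap N N (λ k m → f m * f (k ℕ.+ m)) ⟩
  ∑ N (λ m → ∑ N (λ k → f m * f (k ℕ.+ m)))    ≡⟨ ∑-cong N (λ m _ → ∑-*ˡ N (f m) (λ k → f (k ℕ.+ m))) ⟩
  ∑ N (λ m → f m * ∑ N (λ k → f (k ℕ.+ m)))    ≡⟨ ∑-cong N (λ m _ → cong (f m *_) (rowSum m)) ⟩
  ∑ N (λ m → f m * ∑ N f)                      ≡⟨ ∑-cong N (λ m _ → *-comm (f m) (∑ N f)) ⟩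
  ∑ N (λ m → ∑ N f * f m)                      ≡⟨ ∑-*ˡ N (∑ N f) f ⟩
  ∑ N f * ∑ N f                                ∎
  where
  open ≡-Reasoning
  rowSum : ∀ m → ∑ N (λ k → f (k ℕ.+ m)) ≡ ∑ N f
  rowSum m = trans (∑-cong N (λ k _ → cong f (ℕP.+-comm k m))) (∑-shift N f per m)

-- The autocorrelation computed with the lag taken backwards, as it appears in a circulant Gram matrix.
autocorr-backward : ∀ N (f : ℕ → ℚ) → Periodic N f → ∀ k → k ≤ N →
                    ∑ N (λ m → f (m ℕ.+ (N ∸ k)) * f m) ≡ autocorr N f k
autocorr-backward N f per k k≤N = begin
  ∑ N g                                ≡⟨ sym (∑-shift N g g-periodic k) ⟩
  ∑ N (λ m → g (k ℕ.+ m))              ≡⟨ ∑-cong N (λ m _ → cong (_* f (k ℕ.+ m)) back) ⟩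
  ∑ N (λ m → f m * f (k ℕ.+ m))        ∎
  where
  open ≡-Reasoning
  g : ℕ → ℚ
  g m = f (m ℕ.+ (N ∸ k)) * f m
  g-periodic : Periodic N g
  g-periodic m = cong₂ _*_ (trans (cong f (xy∙z≈xz∙y m N (N ∸ k))) (per (m ℕ.+ (N ∸ k)))) (per m)
  back : ∀ {m} → f (k ℕ.+ m ℕ.+ (N ∸ k)) ≡ f m
  back {m} = trans (cong f (trans (xy∙z≈y∙xz k m (N ∸ k)) (cong (m ℕ.+_) (ℕP.m+[n∸m]≡n k≤N)))) (per m)

extend : {n : ℕ} → (Fin (suc n) → ℚ) → ℕ → ℚ
extend {n} c x = c (fromℕ< (m%n<n x (suc n)))

extend-periodic : ∀ {n} (c : Fin (suc n) → ℚ) → Periodic (suc n) (extend c)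
extend-periodic {n} c m = cong c (FinP.fromℕ<-cong _ _ ([m+n]%n≡m%n m (suc n)) _ _)

extend-toℕ : ∀ {n} (c : Fin (suc n) → ℚ) (k : Fin (suc n)) → extend c (toℕ k) ≡ c k
extend-toℕ {n} c k =
  cong c (trans (FinP.fromℕ<-cong _ _ (m<n⇒m%n≡m (FinP.toℕ<n k)) _ (FinP.toℕ<n k)) (FinP.fromℕ<-toℕ k _))

fromFin : ∀ {n} {P : ℕ → Set} → ((k : Fin n) → P (toℕ k)) → ∀ m → m < n → P m
fromFin {P = P} hyp m m<n = subst P (FinP.toℕ-fromℕ< m<n) (hyp (fromℕ< m<n))

sumFin-∑ : ∀ N (f : ℕ → ℚ) → sumFin N (λ k → f (toℕ k)) ≡ ∑ N f
sumFin-∑ zero f = refl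
sumFin-∑ (suc N) f = cong (f 0 +_) (sumFin-∑ N (λ m → f (suc m)))

gram-autocorr : ∀ {n} (c : Fin (suc n) → ℚ) k (k<n : k < suc n) →
  mulTranspose (circulant c) (circulant c) (fromℕ< k<n) fzero ≡ autocorr (suc n) (extend c) k
gram-autocorr {n} c k k<n = begin
  mulTranspose (circulant c) (circulant c) (fromℕ< k<n) fzero
    ≡⟨ sumFin-∑ N (λ m → C (m ℕ.+ (N ∸ toℕ (fromℕ< k<n))) * C (m ℕ.+ N)) ⟩
  ∑ N (λ m → C (m ℕ.+ (N ∸ toℕ (fromℕ< k<n))) * C (m ℕ.+ N))
    ≡⟨ ∑-cong N (λ m _ → cong₂ _*_ (cong (λ i → C (m ℕ.+ (N ∸ i))) (FinP.toℕ-fromℕ< k<n))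
                                     (extend-periodic c m)) ⟩
  ∑ N (λ m → C (m ℕ.+ (N ∸ k)) * C m)
    ≡⟨ autocorr-backward N C (extend-periodic c) k (ℕP.<⇒≤ k<n) ⟩
  autocorr N C k ∎
  where
  open ≡-Reasoning
  N = suc n
  C = extend c

scalarId-diag : ∀ {n} (a : ℚ) (i : Fin n) → scalarId a i i ≡ a
scalarId-diag a i with i Fin.≟ i
... | yes _ = refl
... | no i≢i = ⊥-elim (i≢i refl)

scalarId-offdiag : ∀ {n} (a : ℚ) (i j : Fin n) → i ≢ j → scalarId a i j ≡ 0ℚ
scalarId-offdiag a i j i≢j with i Fin.≟ j
... | yes i≡j = ⊥-elim (i≢j i≡j)
... | no _ = refl

gram-diag : ∀ {n} (c : Fin (suc n) → ℚ) λ′ →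
            (∀ i j → mulTranspose (circulant c) (circulant c) i j ≡ scalarId λ′ i j) →
            autocorr (suc n) (extend c) 0 ≡ λ′
gram-diag {n} c λ′ gram = trans (sym (gram-autocorr c 0 z<s)) (trans (gram fzero fzero) (scalarId-diag {suc n} λ′ fzero))

gram-offdiag : ∀ {n} (c : Fin (suc n) → ℚ) λ′ →
               (∀ i j → mulTranspose (circulant c) (circulant c) i j ≡ scalarId λ′ i j) →
               ∀ k → 0 < k → k < suc n → autocorr (suc n) (extend c) k ≡ 0ℚ
gram-offdiag c λ′ gram k 0<k k<n =
  trans (sym (gram-autocorr c k k<n)) (trans (gram (fromℕ< k<n) fzero) (scalarId-offdiag λ′ _ _ k≢0))
  where
  k≢0 : fromℕ< k<n ≢ fzero
  k≢0 k≡0 = ℕP.>⇒≢ 0<k (trans (sym (FinP.toℕ-fromℕ< k<n)) (cong toℕ k≡0))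

extend-signs : ∀ {n} (c : Fin (suc n) → ℚ) → (∀ k → toℕ k ≢ 0 → IsSign (c k)) →
               ∀ m → 0 < m → m < suc n → IsSign (extend c m)
extend-signs c signs m 0<m m<n =
  fromFin {P = λ m → 0 < m → IsSign (extend c m)}
          (λ k 0<k → subst IsSign (sym (extend-toℕ c k)) (signs k (ℕP.>⇒≢ 0<k))) m m<n 0<m

extend-cond : ∀ {n} (c : Fin (suc n) → ℚ) → (∀ k → toℕ k ≢ 0 → (c k ≡ 1ℚ) ⊎ (c (negIdx k) ≡ 1ℚ)) →
              ∀ m → 0 < m → m < suc n → (extend c m ≡ 1ℚ) ⊎ (extend c (suc n ∸ m) ≡ 1ℚ)
extend-cond {n} c cond m 0<m m<n =
  fromFin {P = λ m → 0 < m → (extend c m ≡ 1ℚ) ⊎ (extend c (suc n ∸ m) ≡ 1ℚ)}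
          (λ k 0<k → map₁ (trans (extend-toℕ c k)) (cond k (ℕP.>⇒≢ 0<k))) m m<n 0<m

module CirculantStructure
  (t : ℕ) (C : ℕ → ℚ) (d : ℚ)
  (periodic : Periodic (2 ℕ.+ t) C)
  (hd : d ≡ ℕtoℚ (2 ℕ.+ t) * ½ - 1ℚ)
  (C0 : C 0 ≡ d)
  (signs : ∀ m → 0 < m → m < 2 ℕ.+ t → IsSign (C m))
  (orth0 : autocorr (2 ℕ.+ t) C 0 ≡ d * d + (ℕtoℚ (2 ℕ.+ t) - 1ℚ))
  (orth : ∀ k → 0 < k → k < 2 ℕ.+ t → autocorr (2 ℕ.+ t) C k ≡ 0ℚ)
  (cond : ∀ m → 0 < m → m < 2 ℕ.+ t → (C m ≡ 1ℚ) ⊎ (C (2 ℕ.+ t ∸ m) ≡ 1ℚ))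
  where

  n : ℕ
  n = 2 ℕ.+ t

  n≡2[d+1] : ℕtoℚ n ≡ (d + 1ℚ) + (d + 1ℚ)
  n≡2[d+1] = begin
    ℕtoℚ n
      ≡⟨ solve 1 (λ x → x := ((x :* con ½ :- con 1ℚ) :+ con 1ℚ) :+ ((x :* con ½ :- con 1ℚ) :+ con 1ℚ)) refl (ℕtoℚ n) ⟩
    (e + 1ℚ) + (e + 1ℚ)
      ≡⟨ cong (λ x → (x + 1ℚ) + (x + 1ℚ)) (sym hd) ⟩
    (d + 1ℚ) + (d + 1ℚ) ∎
    where
    open ≡-Reasoning
    e = ℕtoℚ n * ½ - 1ℚ

  tail : ℚ
  tail = ∑ (suc t) (λ j → C (suc j))

  rowSum² : (d + tail) * (d + tail) ≡ d * d + (ℕtoℚ n - 1ℚ)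
  rowSum² = begin
    (d + tail) * (d + tail)            ≡⟨ cong (λ x → (x + tail) * (x + tail)) (sym C0) ⟩
    ∑ n C * ∑ n C                      ≡⟨ sym (autocorr-total n C periodic) ⟩
    ∑ n (autocorr n C)                 ≡⟨ cong₂ _+_ orth0 (∑-zero (suc t) _ (λ k k<n → orth (suc k) z<s (s≤s k<n))) ⟩
    d * d + (ℕtoℚ n - 1ℚ) + 0ℚ         ≡⟨ +-identityʳ _ ⟩
    d * d + (ℕtoℚ n - 1ℚ)              ∎
    where open ≡-Reasoning

  -- Since n = 2d + 2, the row sum equation factors as (tail - 1)(tail + n - 1) = 0.
  tail-factor : (tail + ℕtoℚ (suc t)) * (tail - 1ℚ) ≡ 0ℚ
  tail-factor = begin
    (tail + N′) * (tail - 1ℚ)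
      ≡⟨ solve 3 (λ d s N′ → (s :+ N′) :* (s :- con 1ℚ)
                     := ((d :+ s) :* (d :+ s) :- (d :* d :+ ((con 1ℚ :+ N′) :- con 1ℚ)))
                        :+ s :* ((con 1ℚ :+ N′) :- ((d :+ con 1ℚ) :+ (d :+ con 1ℚ)))) refl d tail N′ ⟩
    ((d + tail) * (d + tail) - R) + tail * (ℕtoℚ n - T)
      ≡⟨ cong₂ (λ x y → (x - R) + tail * (y - T)) rowSum² n≡2[d+1] ⟩
    (R - R) + tail * (T - T)
      ≡⟨ solve 3 (λ R s T → (R :- R) :+ s :* (T :- T) := con 0ℚ) refl R tail T ⟩
    0ℚ ∎
    where
    open ≡-Reasoning
    N′ = ℕtoℚ (suc t)
    R = d * d + (ℕtoℚ n - 1ℚ)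
    T = (d + 1ℚ) + (d + 1ℚ)

  -- tail = -(n - 1) would force every cₖ = -1, violating the hypothesis at k = 1.
  tail+n-1≢0 : tail + ℕtoℚ (suc t) ≢ 0ℚ
  tail+n-1≢0 sum≡0 = [ contradiction 0 z<s , contradiction t (ℕP.n<1+n t) ]′ (cond 1 z<s (s≤s (s≤s z≤n)))
    where
    shifted : tail + ℕtoℚ (suc t) ≡ ∑ (suc t) (λ j → 1ℚ + C (suc j))
    shifted = sym (trans (∑-+ (suc t) (λ _ → 1ℚ) (λ j → C (suc j)))
                         (trans (cong (_+ tail) (∑-const1 (suc t))) (+-comm _ tail)))
    all-1 : ∀ j → j < suc t → 1ℚ + C (suc j) ≡ 0ℚ
    all-1 = ∑-nonneg-zero (suc t) _ (λ j j<n → sign-1+ (signs (suc j) z<s (s≤s j<n))) (trans (sym shifted) sum≡0)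
    contradiction : ∀ j → j < suc t → C (suc j) ≡ 1ℚ → ⊥
    contradiction j j<n Cj≡1 = 2≢0 (subst (λ x → 1ℚ + x ≡ 0ℚ) Cj≡1 (all-1 j j<n))

  tail≡1 : tail ≡ 1ℚ
  tail≡1 = begin
    tail                ≡⟨ solve 1 (λ s → s := (s :- con 1ℚ) :+ con 1ℚ) refl tail ⟩
    (tail - 1ℚ) + 1ℚ    ≡⟨ cong (_+ 1ℚ) (*-zero-cancel _ _ tail+n-1≢0 tail-factor) ⟩
    0ℚ + 1ℚ             ≡⟨ +-identityˡ 1ℚ ⟩
    1ℚ                  ∎
    where open ≡-Reasoning

  -- n - 1 signs summing to 1 force n - 1 to be odd, so n = 2h.
  halfPeriod : Σ ℕ λ M → n ≡ suc M ℕ.+ suc M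
  halfPeriod with sign-count (suc t) (λ j → C (suc j)) (λ j j<n → signs (suc j) z<s (s≤s j<n))
  ... | M , sum≡ , _ = M , cong suc (trans (cong suc n-1≡2M+1) (sym double))
    where
    n-1≡2M+1 : t ≡ 2 ℕ.* M
    n-1≡2M+1 = ℕP.suc-injective (ℕtoℚ-injective _ _ (trans sum≡ (cong (_+ ℕtoℚ (2 ℕ.* M)) tail≡1)))
    double : M ℕ.+ suc M ≡ suc (2 ℕ.* M)
    double = trans (ℕP.+-suc M M) (cong (λ x → suc (M ℕ.+ x)) (sym (ℕP.+-identityʳ M)))

  module Half (M : ℕ) (n≡h+h : n ≡ suc M ℕ.+ suc M) where

    h : ℕ
    h = suc M

    h<n : h < n
    h<n = subst (h <_) (sym n≡h+h) (ℕP.m<m+n h z<s)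

    sign< : ∀ m → 0 < m → m < h → IsSign (C m)
    sign< m 0<m m<h = signs m 0<m (ℕP.<-trans m<h h<n)

    C-n : C n ≡ d
    C-n = trans (periodic 0) C0

    -- The hypothesis at k = h (where n - h = h) gives c_h = 1.
    C-half : C h ≡ 1ℚ
    C-half = [ id , trans (cong C (sym n∸h≡h)) ]′ (cond h z<s h<n)
      where
      n∸h≡h : n ∸ h ≡ h
      n∸h≡h = trans (cong (_∸ h) n≡h+h) (ℕP.m+n∸n≡m h h)

    C-2h : ∀ m → C (h ℕ.+ (h ℕ.+ m)) ≡ C m
    C-2h m = trans (cong C (trans (sym (ℕP.+-assoc h h m))
                     (trans (cong (ℕ._+ m) (sym n≡h+h)) (ℕP.+-comm n m)))) (periodic m)

    -- The terms of n + A(h), which are nonnegative for 0 < m < h.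
    lagH : ℕ → ℚ
    lagH m = 1ℚ + C m * C (h ℕ.+ m)

    lagH-nonneg : ∀ j → j < M → 0ℚ ≤ℚ lagH (suc j)
    lagH-nonneg j j<M = sign-1+ (sign-* (sign< (suc j) z<s (s≤s j<M)) (signs (h ℕ.+ suc j) z<s h+j<n))
      where
      h+j<n : h ℕ.+ suc j < n
      h+j<n = subst (h ℕ.+ suc j <_) (sym n≡h+h) (ℕP.+-monoʳ-< h (s≤s j<M))

    -- ∑_{m<n} lagH m = n + A(h) = n = 2(d + 1). The sum consists of two equal halves, each of
    -- which is lagH 0 = 1 + d plus the terms m = 1, …, h - 1; hence those terms sum to 0.
    lagH-interior≡0 : ∑ M (λ j → lagH (suc j)) ≡ 0ℚ
    lagH-interior≡0 = nonneg-+-zero (∑-nonneg M _ lagH-nonneg) (∑-nonneg M _ lagH-nonneg) (begin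
      R + R
        ≡⟨ solve 2 (λ d R → R :+ R := (((con 1ℚ :+ d) :+ R) :+ ((con 1ℚ :+ d) :+ R)) :- ((d :+ con 1ℚ) :+ (d :+ con 1ℚ))) refl d R ⟩
      (((1ℚ + d) + R) + ((1ℚ + d) + R)) - T
        ≡⟨ cong (λ x → (x + R) + (x + R) - T) (sym lagH-0) ⟩
      (∑ h lagH + ∑ h lagH) - T
        ≡⟨ cong (_- T) (trans halves (trans ∑lagH n≡2[d+1])) ⟩
      T - T
        ≡⟨ solve 1 (λ x → x :- x := con 0ℚ) refl T ⟩
      0ℚ ∎)
      where
      open ≡-Reasoning
      R = ∑ M (λ j → lagH (suc j))
      T = (d + 1ℚ) + (d + 1ℚ)
      ∑lagH : ∑ n lagH ≡ ℕtoℚ n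
      ∑lagH = begin
        ∑ n lagH                                  ≡⟨ ∑-+ n (λ _ → 1ℚ) (λ m → C m * C (h ℕ.+ m)) ⟩
        ∑ n (λ _ → 1ℚ) + autocorr n C h           ≡⟨ cong₂ _+_ (∑-const1 n) (orth h z<s h<n) ⟩
        ℕtoℚ n + 0ℚ                               ≡⟨ +-identityʳ (ℕtoℚ n) ⟩
        ℕtoℚ n                                    ∎
      halves : ∑ h lagH + ∑ h lagH ≡ ∑ n lagH
      halves = sym (trans (cong (λ N → ∑ N lagH) n≡h+h) (trans (∑-split h h lagH) (cong (∑ h lagH +_)
                 (∑-cong h (λ m _ → cong (1ℚ +_) (trans (cong (C (h ℕ.+ m) *_) (C-2h m)) (*-comm (C (h ℕ.+ m)) (C m))))))))
      lagH-0 : lagH 0 ≡ 1ℚ + d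
      lagH-0 = cong (1ℚ +_) (trans (cong₂ _*_ C0 (trans (cong C (ℕP.+-identityʳ h)) C-half)) (*-identityʳ d))

    anti-low : ∀ m → 0 < m → m < h → C (h ℕ.+ m) ≡ - C m
    anti-low (suc j) _ (s≤s j<M) =
      sign-opposite (C (h ℕ.+ suc j)) (sign< (suc j) z<s (s≤s j<M))
                    (∑-nonneg-zero M _ lagH-nonneg lagH-interior≡0 j j<M)

    anti : ∀ x → 0 < x → x < n → x ≢ h → C (h ℕ.+ x) ≡ - C x
    anti x 0<x x<n x≢h with ℕP.<-cmp x h
    ... | tri< x<h _ _ = anti-low x 0<x x<h
    ... | tri≈ _ x≡h _ = ⊥-elim (x≢h x≡h)
    ... | tri> _ _ h<x = begin
      C (h ℕ.+ x)              ≡⟨ cong (λ z → C (h ℕ.+ z)) (sym h+y≡x) ⟩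
      C (h ℕ.+ (h ℕ.+ y))      ≡⟨ C-2h y ⟩
      C y                      ≡⟨ solve 1 (λ a → a := :- (:- a)) refl (C y) ⟩
      - (- C y)                ≡⟨ cong -_ (sym (anti-low y 0<y y<h)) ⟩
      - C (h ℕ.+ y)            ≡⟨ cong (λ z → - C z) h+y≡x ⟩
      - C x                    ∎
      where
      open ≡-Reasoning
      y = x ∸ h
      h+y≡x : h ℕ.+ y ≡ x
      h+y≡x = ℕP.m+[n∸m]≡n (ℕP.<⇒≤ h<x)
      0<y : 0 < y
      0<y = ℕP.m<n⇒0<n∸m h<x
      y<h : y < h
      y<h = ℕP.+-cancelˡ-< h y h (subst₂ _<_ (sym h+y≡x) n≡h+h x<n)

    -- For a + b = h the hypothesis "c_a = 1 or c_{n-a} = 1" reads c_a = 1 or -c_b = 1,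
    -- since n - a = h + b and c_{h+b} = -c_b.
    cond-half : ∀ a b → 0 < a → 0 < b → a ℕ.+ b ≡ h → (C a ≡ 1ℚ) ⊎ (- C b ≡ 1ℚ)
    cond-half a b 0<a 0<b a+b≡h = map₂ (trans (sym opposite)) (cond a 0<a a<n)
      where
      b<h : b < h
      b<h = subst (b <_) a+b≡h (ℕP.m<n+m b 0<a)
      a<n : a < n
      a<n = ℕP.<-trans (subst (a <_) a+b≡h (ℕP.m<m+n a 0<b)) h<n
      n∸a≡h+b : n ∸ a ≡ h ℕ.+ b
      n∸a≡h+b = begin
        n ∸ a                        ≡⟨ cong (λ x → x ∸ a) n≡h+h ⟩
        (h ℕ.+ h) ∸ a                ≡⟨ cong (λ x → (h ℕ.+ x) ∸ a) (trans (sym a+b≡h) (ℕP.+-comm a b)) ⟩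
        (h ℕ.+ (b ℕ.+ a)) ∸ a        ≡⟨ cong (_∸ a) (sym (ℕP.+-assoc h b a)) ⟩
        (h ℕ.+ b ℕ.+ a) ∸ a          ≡⟨ ℕP.m+n∸n≡m (h ℕ.+ b) a ⟩
        h ℕ.+ b                      ∎
        where open ≡-Reasoning
      opposite : C (n ∸ a) ≡ - C b
      opposite = trans (cong C n∸a≡h+b) (anti-low b 0<b b<h)

    -- Applying this to (i, j) and to (j, i) forbids c_i ≠ c_j: c_1, …, c_{h-1} is a palindrome.
    palindrome : ∀ i j → 0 < i → 0 < j → i ℕ.+ j ≡ h → C i ≡ C j
    palindrome i j 0<i 0<j i+j≡h =
      signs-agree (sign< i 0<i (subst (i <_) i+j≡h (ℕP.m<m+n i 0<j)))
                  (sign< j 0<j (subst (j <_) i+j≡h (ℕP.m<n+m j 0<i)))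
                  (cond-half i j 0<i 0<j i+j≡h)
                  (cond-half j i 0<j 0<i (trans (ℕP.+-comm j i) i+j≡h))

    -- For a lag k with k + p = h (0 < k, p = suc q) the second half of the lag-k sum repeats the
    -- first half, except at m = 0 and m = p, where it differs by -(d + 1) c_k each time.
    module Lag (k q : ℕ) (0<k : 0 < k) (k+p≡h : k ℕ.+ suc q ≡ h) where

      p : ℕ
      p = suc q

      f : ℕ → ℚ
      f m = C m * C (k ℕ.+ m)

      defect : ℕ → ℚ
      defect m = f (h ℕ.+ m) - f m

      k<h : k < h
      k<h = subst (k <_) k+p≡h (ℕP.m<m+n k z<s)

      p<h : p < h
      p<h = subst (p <_) k+p≡h (ℕP.m<n+m p 0<k)

      q<M : q < M
      q<M = ℕP.≤-pred (subst (suc q <_) k+p≡h (ℕP.m<n+m (suc q) 0<k))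

      -- Away from m = 0 and m = p, both factors of f change sign when m is shifted by h.
      defect-vanishes : ∀ j → j < M → j ≢ q → defect (suc j) ≡ 0ℚ
      defect-vanishes j j<M j≢q = begin
        C (h ℕ.+ m) * C (k ℕ.+ (h ℕ.+ m)) - f m
          ≡⟨ cong (λ x → C (h ℕ.+ m) * C x - f m) (x∙yz≈y∙xz k h m) ⟩
        C (h ℕ.+ m) * C (h ℕ.+ (k ℕ.+ m)) - f m
          ≡⟨ cong₂ (λ x y → x * y - f m) (anti-low m z<s (s≤s j<M)) (anti (k ℕ.+ m) (ℕP.<-≤-trans 0<k (ℕP.m≤m+n k m)) k+m<n k+m≢h) ⟩
        (- C m) * (- C (k ℕ.+ m)) - C m * C (k ℕ.+ m)
          ≡⟨ solve 2 (λ a b → (:- a) :* (:- b) :- a :* b := con 0ℚ) refl (C m) (C (k ℕ.+ m)) ⟩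
        0ℚ ∎
        where
        open ≡-Reasoning
        m = suc j
        k+m<n : k ℕ.+ m < n
        k+m<n = subst (k ℕ.+ m <_) (sym n≡h+h) (ℕP.+-mono-< k<h (s≤s j<M))
        k+m≢h : k ℕ.+ m ≢ h
        k+m≢h k+m≡h = j≢q (ℕP.suc-injective (ℕP.+-cancelˡ-≡ k m p (trans k+m≡h (sym k+p≡h))))

      defect-0 : defect 0 ≡ - ((d + 1ℚ) * C k)
      defect-0 = begin
        C (h ℕ.+ 0) * C (k ℕ.+ (h ℕ.+ 0)) - C 0 * C (k ℕ.+ 0)
          ≡⟨ cong₂ (λ x y → C x * C y - C 0 * C (k ℕ.+ 0)) (ℕP.+-identityʳ h) k+h+0≡h+k ⟩
        C h * C (h ℕ.+ k) - C 0 * C (k ℕ.+ 0)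
          ≡⟨ cong₂ (λ x y → x * y - C 0 * C (k ℕ.+ 0)) C-half (anti-low k 0<k k<h) ⟩
        1ℚ * (- C k) - C 0 * C (k ℕ.+ 0)
          ≡⟨ cong₂ (λ x y → 1ℚ * (- C k) - x * C y) C0 (ℕP.+-identityʳ k) ⟩
        1ℚ * (- C k) - d * C k
          ≡⟨ solve 2 (λ d c → con 1ℚ :* (:- c) :- d :* c := :- ((d :+ con 1ℚ) :* c)) refl d (C k) ⟩
        - ((d + 1ℚ) * C k) ∎
        where
        open ≡-Reasoning
        k+h+0≡h+k : k ℕ.+ (h ℕ.+ 0) ≡ h ℕ.+ k
        k+h+0≡h+k = trans (cong (k ℕ.+_) (ℕP.+-identityʳ h)) (ℕP.+-comm k h)

      defect-p : defect p ≡ - ((d + 1ℚ) * C k)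
      defect-p = begin
        C (h ℕ.+ p) * C (k ℕ.+ (h ℕ.+ p)) - C p * C (k ℕ.+ p)
          ≡⟨ cong₂ (λ x y → x * C y - C p * C (k ℕ.+ p)) (anti-low p z<s p<h) k+h+p≡n ⟩
        (- C p) * C n - C p * C (k ℕ.+ p)
          ≡⟨ cong₂ (λ x y → (- C p) * x - C p * C y) C-n k+p≡h ⟩
        (- C p) * d - C p * C h
          ≡⟨ cong₂ (λ x y → (- x) * d - x * y) (sym (palindrome k p 0<k z<s k+p≡h)) C-half ⟩
        (- C k) * d - C k * 1ℚ
          ≡⟨ solve 2 (λ d c → (:- c) :* d :- c :* con 1ℚ := :- ((d :+ con 1ℚ) :* c)) refl d (C k) ⟩
        - ((d + 1ℚ) * C k) ∎
        where
        open ≡-Reasoning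
        k+h+p≡n : k ℕ.+ (h ℕ.+ p) ≡ n
        k+h+p≡n = trans (x∙yz≈y∙xz k h p) (trans (cong (h ℕ.+_) k+p≡h) (sym n≡h+h))

      -- Hence orthogonality at lag k reads 2 ∑_{m<h} f m - 2 (d + 1) c_k = 0.
      halfSum : ∑ h f ≡ (d + 1ℚ) * C k
      halfSum = begin
        X                 ≡⟨ solve 2 (λ X E → X := (X :- E) :+ E) refl X E ⟩
        (X - E) + E       ≡⟨ cong (_+ E) (*-zero-cancel (1ℚ + 1ℚ) (X - E) 2≢0 twice) ⟩
        0ℚ + E            ≡⟨ +-identityˡ E ⟩
        E                 ∎
        where
        open ≡-Reasoning
        X = ∑ h f
        E = (d + 1ℚ) * C k
        halves : ∑ n f ≡ X + ∑ h (λ m → f (h ℕ.+ m))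
        halves = trans (cong (λ N → ∑ N f) n≡h+h) (∑-split h h f)
        secondHalf : ∑ h (λ m → f (h ℕ.+ m)) ≡ X + ∑ h defect
        secondHalf = trans (∑-cong h (λ m _ → solve 2 (λ x y → x := y :+ (x :- y)) refl (f (h ℕ.+ m)) (f m)))
                           (∑-+ h f defect)
        ∑defect : ∑ h defect ≡ defect 0 + defect p
        ∑defect = cong (defect 0 +_) (∑-single M q (λ j → defect (suc j)) q<M defect-vanishes)
        twice : (1ℚ + 1ℚ) * (X - E) ≡ 0ℚ
        twice = begin
          (1ℚ + 1ℚ) * (X - E)                ≡⟨ solve 2 (λ X E → (con 1ℚ :+ con 1ℚ) :* (X :- E) := X :+ (X :+ ((:- E) :+ (:- E)))) refl X E ⟩
          X + (X + ((- E) + (- E)))          ≡⟨ cong (λ y → X + (X + y)) (sym (trans ∑defect (cong₂ _+_ defect-0 defect-p))) ⟩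
          X + (X + ∑ h defect)               ≡⟨ cong (X +_) (sym secondHalf) ⟩
          X + ∑ h (λ m → f (h ℕ.+ m))        ≡⟨ sym halves ⟩
          ∑ n f                              ≡⟨ orth k 0<k (ℕP.<-trans k<h h<n) ⟩
          0ℚ                                 ∎

  -- A half-period h = s + 3 ≥ 3 is impossible: with b_j = c_{j+1}, orthogonality at lags 1 and 2
  -- determines the sum and the (telescoping) product of the lag-1 and lag-2 sign products,
  -- and the resulting counts of -1's have incompatible parities.
  module Large (s : ℕ) (n≡h+h : n ≡ suc (suc (suc s)) ℕ.+ suc (suc (suc s))) where
    open Half (suc (suc s)) n≡h+h

    b : ℕ → ℚ
    b j = C (suc j)

    b-sign : ∀ j → j ≤ suc s → IsSign (b j)
    b-sign j j≤ = sign< (suc j) z<s (s≤s (s≤s j≤))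

    C-end1 : C (suc (suc s)) ≡ C 1
    C-end1 = sym (palindrome 1 (suc (suc s)) z<s z<s refl)

    C-end2 : C (suc s) ≡ C 2
    C-end2 = sym (palindrome 2 (suc s) z<s z<s refl)

    C-beyond : C (suc h) ≡ - C 1
    C-beyond = trans (cong C (ℕP.+-comm 1 h)) (anti-low 1 z<s (s≤s (s≤s z≤n)))

    pairs : ℕ → ℕ → ℚ
    pairs k j = b j * b (k ℕ.+ j)

    pairs-sign : ∀ k j → k ℕ.+ j ≤ suc s → IsSign (pairs k j)
    pairs-sign k j k+j≤ = sign-* (b-sign j (ℕP.≤-trans (ℕP.m≤n+m j k) k+j≤)) (b-sign (k ℕ.+ j) k+j≤)

    lag1-sum : ∑ (suc s) (pairs 1) ≡ 0ℚ
    lag1-sum = begin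
      X
        ≡⟨ solve 3 (λ d c X → X := (d :* c :+ (X :+ c :* con 1ℚ)) :- (d :+ con 1ℚ) :* c) refl d (C 1) X ⟩
      (d * C 1 + (X + C 1 * 1ℚ)) - E
        ≡⟨ cong₂ (λ x y → (x * C 1 + (X + y)) - E) (sym C0) (sym (cong₂ _*_ C-end1 C-half)) ⟩
      (C 0 * C 1 + (X + pairs 1 (suc s))) - E
        ≡⟨ cong (λ y → (C 0 * C 1 + y) - E) (sym (∑-last (suc s) (pairs 1))) ⟩
      ∑ h (λ m → C m * C (1 ℕ.+ m)) - E
        ≡⟨ cong (_- E) (Lag.halfSum 1 (suc s) z<s refl) ⟩
      E - E
        ≡⟨ solve 1 (λ x → x :- x := con 0ℚ) refl E ⟩
      0ℚ ∎
      where
      open ≡-Reasoning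
      X = ∑ (suc s) (pairs 1)
      E = (d + 1ℚ) * C 1

    -- … and, by telescoping, their product is b_{s+1} / b_0 = c_{h-1} / c_1 = 1.
    lag1-product : ∏ (suc s) (pairs 1) ≡ 1ℚ
    lag1-product = sign-cancel _ 1ℚ (sign-* (b-sign 0 z≤n) (inj₁ refl)) (begin
      ∏ 1 b * ∏ (suc s) (pairs 1)
        ≡⟨ ∏-telescope 1 (suc s) b (λ j j<N → sign² (b-sign j (ℕP.<⇒≤ j<N))) ⟩
      b (suc s ℕ.+ 0) * 1ℚ
        ≡⟨ cong (_* 1ℚ) (trans (cong (λ i → C (suc i)) (ℕP.+-identityʳ (suc s))) C-end1) ⟩
      ∏ 1 b
        ≡⟨ sym (*-identityʳ (∏ 1 b)) ⟩
      ∏ 1 b * 1ℚ ∎)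
      where open ≡-Reasoning

    lag2-sum : ∑ s (pairs 2) ≡ 1ℚ
    lag2-sum = begin
      Y
        ≡⟨ solve 4 (λ d c₁ c₂ Y → Y := ((d :* c₂ :+ ((Y :+ c₂ :* con 1ℚ) :+ c₁ :* (:- c₁))) :- (d :+ con 1ℚ) :* c₂) :+ c₁ :* c₁)
                   refl d (C 1) (C 2) Y ⟩
      ((d * C 2 + ((Y + C 2 * 1ℚ) + C 1 * (- C 1))) - E) + C 1 * C 1
        ≡⟨ cong₂ (λ x y → ((x * C 2 + ((Y + y) + C 1 * (- C 1))) - E) + C 1 * C 1)
                 (sym C0) (sym (cong₂ _*_ C-end2 C-half)) ⟩
      ((C 0 * C 2 + ((Y + pairs 2 s) + C 1 * (- C 1))) - E) + C 1 * C 1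
        ≡⟨ cong (λ y → ((C 0 * C 2 + ((Y + pairs 2 s) + y)) - E) + C 1 * C 1)
                 (sym (cong₂ _*_ C-end1 C-beyond)) ⟩
      ((C 0 * C 2 + ((Y + pairs 2 s) + pairs 2 (suc s))) - E) + C 1 * C 1
        ≡⟨ cong (λ y → ((C 0 * C 2 + (y + pairs 2 (suc s))) - E) + C 1 * C 1) (sym (∑-last s (pairs 2))) ⟩
      ((C 0 * C 2 + (∑ (suc s) (pairs 2) + pairs 2 (suc s))) - E) + C 1 * C 1
        ≡⟨ cong (λ y → ((C 0 * C 2 + y) - E) + C 1 * C 1) (sym (∑-last (suc s) (pairs 2))) ⟩
      (∑ h (λ m → C m * C (2 ℕ.+ m)) - E) + C 1 * C 1
        ≡⟨ cong₂ (λ x y → (x - E) + y) (Lag.halfSum 2 s z<s refl) (sign² (b-sign 0 z≤n)) ⟩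
      (E - E) + 1ℚ
        ≡⟨ solve 1 (λ x → (x :- x) :+ con 1ℚ := con 1ℚ) refl E ⟩
      1ℚ ∎
      where
      open ≡-Reasoning
      Y = ∑ s (pairs 2)
      E = (d + 1ℚ) * C 2

    -- … and, by telescoping, their product is (b_s b_{s+1}) / (b_0 b_1) = (c_{h-2} c_{h-1}) / (c_1 c_2) = 1.
    lag2-product : ∏ s (pairs 2) ≡ 1ℚ
    lag2-product = sign-cancel _ 1ℚ (sign-* (b-sign 0 z≤n) (sign-* (b-sign 1 (s≤s z≤n)) (inj₁ refl))) (begin
      ∏ 2 b * ∏ s (pairs 2)
        ≡⟨ ∏-telescope 2 s b (λ j j<s → sign² (b-sign j (ℕP.<⇒≤ (ℕP.m<n⇒m<1+n j<s)))) ⟩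
      b (s ℕ.+ 0) * (b (s ℕ.+ 1) * 1ℚ)
        ≡⟨ cong₂ (λ x y → x * (y * 1ℚ))
                 (trans (cong (λ i → C (suc i)) (ℕP.+-identityʳ s)) C-end2)
                 (trans (cong (λ i → C (suc i)) (ℕP.+-comm s 1)) C-end1) ⟩
      C 2 * (C 1 * 1ℚ)
        ≡⟨ solve 2 (λ x y → x :* (y :* con 1ℚ) := (y :* (x :* con 1ℚ)) :* con 1ℚ) refl (C 2) (C 1) ⟩
      ∏ 2 b * 1ℚ ∎)
      where open ≡-Reasoning

    noLarge : ⊥
    noLarge = parity-clash s
      (sign-count-even (suc s) (pairs 1) 0 (λ j j<N → pairs-sign 1 j j<N) lag1-sum lag1-product)
      (sign-count-even s (pairs 2) 1 (λ j j<s → pairs-sign 2 j (s≤s j<s)) lag2-sum lag2-product)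

  smallCases : (n ≡ 2 × C 1 ≡ 1ℚ) ⊎ (n ≡ 4 × C 2 ≡ 1ℚ × C 3 ≡ - C 1)
  smallCases = byHalfPeriod halfPeriod
    where
    byHalfPeriod : (Σ ℕ λ M → n ≡ suc M ℕ.+ suc M) → (n ≡ 2 × C 1 ≡ 1ℚ) ⊎ (n ≡ 4 × C 2 ≡ 1ℚ × C 3 ≡ - C 1)
    byHalfPeriod (zero , n≡2) = inj₁ (n≡2 , Half.C-half 0 n≡2)
    byHalfPeriod (suc zero , n≡4) = inj₂ (n≡4 , Half.C-half 1 n≡4 , Half.anti-low 1 n≡4 1 z<s (s≤s (s≤s z≤n)))
    byHalfPeriod (suc (suc s) , n≡h+h) = ⊥-elim (Large.noLarge s n≡h+h)

byEvaluation : ∀ {n} (A B : Mat n) → True (FinP.all? λ i → FinP.all? λ j → A i j ≟ B i j) → ∀ i j → A i j ≡ B i j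
byEvaluation A B ok = toWitness ok

circulant-cong : ∀ {n} {c g : Fin n → ℚ} → (∀ k → c k ≡ g k) → ∀ i j → circulant c i j ≡ circulant g i j
circulant-cong c≡g i j = c≡g (modSub j i)

circulant₂ : ∀ (c : Fin 2 → ℚ) → c fzero ≡ 0ℚ → c (fsuc fzero) ≡ 1ℚ →
             ∀ i j → circulant c i j ≡ C₂ (cast refl i) (cast refl j)
circulant₂ c c₀ c₁ i j = trans (circulant-cong values i j) (byEvaluation (circulant g) (λ i j → C₂ (cast refl i) (cast refl j)) _ i j)
  where
  g = lookup (0ℚ ∷ 1ℚ ∷ [])
  values : ∀ k → c k ≡ g k
  values fzero = c₀
  values (fsuc fzero) = c₁

generator₄ : ℚ → Fin 4 → ℚ
generator₄ x = lookup (1ℚ ∷ x ∷ 1ℚ ∷ - x ∷ [])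

generator₄-values : ∀ (c : Fin 4 → ℚ) x → c fzero ≡ 1ℚ → c (fsuc fzero) ≡ x →
                    c (fsuc (fsuc fzero)) ≡ 1ℚ → c (fsuc (fsuc (fsuc fzero))) ≡ - c (fsuc fzero) →
                    ∀ k → c k ≡ generator₄ x k
generator₄-values c x c₀ c₁ c₂ c₃ fzero = c₀
generator₄-values c x c₀ c₁ c₂ c₃ (fsuc fzero) = c₁
generator₄-values c x c₀ c₁ c₂ c₃ (fsuc (fsuc fzero)) = c₂
generator₄-values c x c₀ c₁ c₂ c₃ (fsuc (fsuc (fsuc fzero))) = trans c₃ (cong -_ c₁)

circulant₄ : ∀ (c : Fin 4 → ℚ) → c fzero ≡ 1ℚ → IsSign (c (fsuc fzero)) →
             c (fsuc (fsuc fzero)) ≡ 1ℚ → c (fsuc (fsuc (fsuc fzero))) ≡ - c (fsuc fzero) →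
             ((i j : Fin 4) → circulant c i j ≡ C₄a (cast refl i) (cast refl j))
             ⊎ ((i j : Fin 4) → circulant c i j ≡ C₄b (cast refl i) (cast refl j))
circulant₄ c c₀ (inj₁ c₁) c₂ c₃ = inj₁ λ i j →
  trans (circulant-cong (generator₄-values c 1ℚ c₀ c₁ c₂ c₃) i j)
        (byEvaluation (circulant (generator₄ 1ℚ)) (λ i j → C₄a (cast refl i) (cast refl j)) _ i j)
circulant₄ c c₀ (inj₂ c₁) c₂ c₃ = inj₂ λ i j →
  trans (circulant-cong (generator₄-values c -1ℚ c₀ c₁ c₂ c₃) i j)
        (byEvaluation (circulant (generator₄ -1ℚ)) (λ i j → C₄b (cast refl i) (cast refl j)) _ i j)

Conclusion : (n : ℕ) → (Fin n → ℚ) → Set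
Conclusion n c =
  (Σ (n ≡ 2) λ e → (i j : Fin n) → circulant c i j ≡ C₂ (cast e i) (cast e j))
  ⊎ (Σ (n ≡ 4) λ e → ((i j : Fin n) → circulant c i j ≡ C₄a (cast e i) (cast e j))
                     ⊎ ((i j : Fin n) → circulant c i j ≡ C₄b (cast e i) (cast e j)))

conclude : ∀ t (c : Fin (suc (suc t)) → ℚ) → c fzero ≡ ℕtoℚ (suc (suc t)) * ½ - 1ℚ → IsSign (c (fsuc fzero)) →
           (suc (suc t) ≡ 2 × extend c 1 ≡ 1ℚ) ⊎ (suc (suc t) ≡ 4 × extend c 2 ≡ 1ℚ × extend c 3 ≡ - extend c 1) →
           Conclusion (suc (suc t)) c
conclude t c c₀ _ (inj₁ (refl , c₁)) = inj₁ (refl , circulant₂ c c₀ c₁)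
conclude t c c₀ c₁-sign (inj₂ (refl , c₂ , c₃)) = inj₂ (refl , circulant₄ c c₀ c₁-sign c₂ c₃)

proposition5p1 : (n : ℕ) → 2 ≤ n → (c : Fin n → ℚ) → (d : ℚ)
    → d ≡ ℕtoℚ n * ½ - 1ℚ
    → ((k : Fin n) → toℕ k ≡ 0 → c k ≡ d)
    → ((k : Fin n) → toℕ k ≢ 0 → (c k ≡ 1ℚ) ⊎ (c k ≡ -1ℚ))
    → ((i j : Fin n) → mulTranspose (circulant c) (circulant c) i j ≡ scalarId (d * d + (ℕtoℚ n - 1ℚ)) i j)
    → ((k : Fin n) → toℕ k ≢ 0 → (c k ≡ 1ℚ) ⊎ (c (negIdx k) ≡ 1ℚ))
    → (Σ (n ≡ 2) λ e → (i j : Fin n) → circulant c i j ≡ C₂ (cast e i) (cast e j))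
    ⊎ (Σ (n ≡ 4) λ e → ((i j : Fin n) → circulant c i j ≡ C₄a (cast e i) (cast e j))
    ⊎ ((i j : Fin n) → circulant c i j ≡ C₄b (cast e i) (cast e j)))
proposition5p1 (suc zero) (s≤s ()) c d hd h0 hpm horth hcond
proposition5p1 (suc (suc t)) _ c d hd h0 hpm horth hcond =
  conclude t c (trans (h0 fzero refl) hd) (hpm (fsuc fzero) (λ ()))
    (CirculantStructure.smallCases t (extend c) d (extend-periodic c) hd (h0 fzero refl)
      (extend-signs c hpm) (gram-diag c _ horth) (gram-offdiag c _ horth) (extend-cond c hcond))
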